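{- Let $\phi=(1+\sqrt5)/2$. For all nonnegative integers $m \neq n$, we have \[(\lfloor \phi m \rfloor, \lfloor \phi m \rfloor +m) \neq (\lfloor \phi n \rfloor - 1, \lfloor \phi n \rfloor +n-1).\] -}

module Defs where

open import Data.Nat using (ℕ; suc; _+_; _*_; _∸_; _^_; _≤_; _<_)
open import Data.Product using (_×_)
import Data.Integer as ℤ

-- φ = (1 + √5)/2.  For m k : ℕ,
--   k ≤ φ·m      ⇔  2k - m ≤ √5·m   ⇔  (2k ∸ m)² ≤ 5m²
--   φ·m < k + 1  ⇔  √5·m < 2(k+1) - m  ⇔  5m² < (2(k+1) ∸ m)²
-- (truncated subtraction handles the cases where the left side is ≤ 0).
-- IsFloorφ m k  says exactly  k = ⌊φ m⌋  (i.e. k ≤ φ m < k + 1).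
IsFloorφ : ℕ → ℕ → Set
IsFloorφ m k = ((2 * k ∸ m) ^ 2 ≤ 5 * m ^ 2) × (5 * m ^ 2 < (2 * suc k ∸ m) ^ 2)

-- The second coordinate minus the first is m on the left and n on the right,
-- so equal pairs force m = n.
module Submission where

open import Defs
open import Data.Nat using (ℕ)
open import Data.Integer using (ℤ; +_; _+_; _-_; 1ℤ)
open import Data.Integer.Properties using (+-0-abelianGroup; +-injective)
open import Data.Integer.Tactic.RingSolver using (solve-∀)
open import Data.Product using (_×_; _,_)
open import Data.Product.Properties using (,-injectiveˡ; ,-injectiveʳ)
open import Algebra.Properties.AbelianGroup +-0-abelianGroup using (∙-cancelˡ)
open import Relation.Binary.PropositionalEquality using (_≡_; _≢_; cong; sym; trans)

+-minus-comm : ∀ (c d : ℤ) → c + d - 1ℤ ≡ (c - 1ℤ) + d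
+-minus-comm = solve-∀

,+-injectiveʳ : ∀ {a b c d : ℤ} → _≡_ {A = ℤ × ℤ} (a , a + b) (c , c + d) → b ≡ d
,+-injectiveʳ {a} {b} {c} {d} eq =
  ∙-cancelˡ a b d (trans (,-injectiveʳ eq) (cong (_+ d) (sym (,-injectiveˡ eq))))

lemma2p5 : (m n k l : ℕ) → m ≢ n → IsFloorφ m k → IsFloorφ n l →
    _≢_ {A = ℤ × ℤ} (+ k , + k + + m) (+ l - 1ℤ , + l + + n - 1ℤ)
lemma2p5 m n k l m≢n _ _ eq =
  m≢n (+-injective (,+-injectiveʳ (trans eq (cong (_ ,_) (+-minus-comm (+ l) (+ n))))))
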